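{- If a finite simple graph $G$ is connected and trivially perfect, then $\alpha'(G)=\theta_e(G)$.
   Context: A graph is trivially perfect if it contains neither the cycle $C_4$ nor the path $P_4$ as an induced subgraph. A set $A$ of edges of $G$ is independent if no two edges of $A$ are contained in a common clique of $G$; $\alpha'(G)$ is the maximum cardinality of an independent set of edges (with $\alpha'(G)=0$ when $G$ has no edges). An edge-clique covering of $G$ is a family of complete subgraphs such that each edge of $G$ lies in at least one member; $\theta_e(G)$ is the minimum cardinality of such a family. -}

module Defs where

open import Data.Nat using (ℕ; _≤_; _<_)
open import Data.Fin using (Fin; toℕ)
open import Data.Fin.Subset using (Subset; _∈_)
open import Data.Bool using (Bool; true; false)
open import Data.List using (List; length; lookup)
open import Data.Product using (Σ; ∃; _×_; _,_; proj₁)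
open import Relation.Binary.PropositionalEquality using (_≡_; _≢_)
open import Relation.Nullary using (¬_)

record Graph (n : ℕ) : Set where
  field
    adj    : Fin n → Fin n → Bool
    sym    : ∀ u v → adj u v ≡ adj v u
    irrefl : ∀ u → adj u u ≡ false

open Graph public

module _ {n : ℕ} (G : Graph n) where

  Adj : Fin n → Fin n → Set
  Adj u v = adj G u v ≡ true

  data Reachable : Fin n → Fin n → Set where
    here : ∀ {u} → Reachable u u
    step : ∀ {u v w} → Adj u v → Reachable v w → Reachable u w

  Connected : Set
  Connected = ∀ u v → Reachable u v

  InducedP4 : Fin n → Fin n → Fin n → Fin n → Set
  InducedP4 a b c d =
    (a ≢ b) × (a ≢ c) × (a ≢ d) × (b ≢ c) × (b ≢ d) × (c ≢ d) ×
    Adj a b × Adj b c × Adj c d ×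
    ¬ Adj a c × ¬ Adj b d × ¬ Adj a d

  InducedC4 : Fin n → Fin n → Fin n → Fin n → Set
  InducedC4 a b c d =
    (a ≢ b) × (a ≢ c) × (a ≢ d) × (b ≢ c) × (b ≢ d) × (c ≢ d) ×
    Adj a b × Adj b c × Adj c d × Adj d a ×
    ¬ Adj a c × ¬ Adj b d

  TriviallyPerfect : Set
  TriviallyPerfect = ∀ a b c d → ¬ InducedP4 a b c d × ¬ InducedC4 a b c d

  IsClique : Subset n → Set
  IsClique S = ∀ u v → u ∈ S → v ∈ S → u ≢ v → Adj u v

  -- an edge {u,v}, represented canonically with toℕ u < toℕ v
  Edge : Set
  Edge = Σ (Fin n × Fin n) λ { (u , v) → (toℕ u < toℕ v) × Adj u v }

  EdgeIn : Edge → Subset n → Set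
  EdgeIn ((u , v) , _) S = u ∈ S × v ∈ S

  CommonClique : Edge → Edge → Set
  CommonClique e f = ∃ λ S → IsClique S × EdgeIn e S × EdgeIn f S

  -- independent set of edges, given as a list; entries at distinct positions
  -- never lie in a common clique (in particular they are distinct edges)
  IndependentEdges : List Edge → Set
  IndependentEdges A = ∀ (i j : Fin (length A)) → i ≢ j →
    ¬ CommonClique (lookup A i) (lookup A j)

  EdgeCliqueCover : List (Subset n) → Set
  EdgeCliqueCover C =
    (∀ (i : Fin (length C)) → IsClique (lookup C i)) ×
    (∀ (e : Edge) → ∃ λ (i : Fin (length C)) → EdgeIn e (lookup C i))

  EdgeIndependenceNumber : ℕ → Set
  EdgeIndependenceNumber k =
    (∃ λ A → IndependentEdges A × length A ≡ k) ×
    (∀ A → IndependentEdges A → length A ≤ k)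

  EdgeCliqueCoverNumber : ℕ → Set
  EdgeCliqueCoverNumber k =
    (∃ λ C → EdgeCliqueCover C × length C ≡ k) ×
    (∀ C → EdgeCliqueCover C → k ≤ length C)

-- In a trivially perfect graph the closed neighbourhoods of adjacent vertices are nested
-- (otherwise two private neighbours would extend the edge to an induced P₄ or C₄). Shrinking
-- closed neighbourhoods therefore leads from the endpoint of an edge ab with the smaller closed
-- neighbourhood to a simplicial vertex t whose closed neighbourhood, a clique, still contains
-- a and b. Adjacent simplicial vertices are twins, so keeping the least simplicial vertex of
-- each twin class yields pairwise non-adjacent vertices whose closed neighbourhoods cover all
-- edges; one edge at each of them is an independent set of the same size. Weak duality
-- α′ ≤ θₑ finishes the proof.
module Submission where

open import Defs
open import Data.Bool using (true)
import Data.Bool as Bool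
open import Data.Empty using (⊥; ⊥-elim)
open import Data.Fin using (Fin; _<_; _≟_)
open import Data.Fin.Induction using (<-wellFounded)
open import Data.Fin.Properties using (any?; all?; _<?_; <-cmp; injective⇒≤)
open import Data.Fin.Subset using (Subset; _∈_; _∉_; _⊆_; _⊂_; ⁅_⁆; _∪_)
open import Data.Fin.Subset.Induction using (⊂-wellFounded)
open import Data.Fin.Subset.Properties
  using (_∈?_; _⊆?_; ⊆-refl; ⊆-trans; x∈⁅x⁆; x∈⁅y⁆⇒x≡y; x∈p∪q⁺; x∈p∪q⁻)
open import Data.List using (List; _∷_; length; lookup; map; allFin)
open import Data.List.Properties using (length-map)
open import Data.List.Membership.Propositional.Properties using (∈-lookup; ∈-allFin; ∈-filter⁺)
open import Data.List.Relation.Unary.All as All using (All; []; _∷_)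
open import Data.List.Relation.Unary.All.Properties using (all-filter)
import Data.List.Relation.Unary.All.Properties as All
open import Data.List.Relation.Unary.Any as Any using (Any)
import Data.List.Relation.Unary.Any.Properties as Any
open import Data.List.Relation.Unary.AllPairs as AllPairs using (AllPairs; _∷_)
import Data.List.Relation.Unary.AllPairs.Properties as AllPairs
open import Data.List.Relation.Unary.Unique.Propositional using (Unique)
import Data.List.Relation.Unary.Unique.Propositional.Properties as Unique
open import Data.Nat using (ℕ; _≤_)
open import Data.Product using (Σ; ∃; ∃₂; _×_; _,_; proj₁; proj₂)
open import Data.Sum using (_⊎_; inj₁; inj₂)
import Data.Sum as Sum
open import Data.Vec using (tabulate)
open import Data.Vec.Properties using (lookup∘tabulate; lookup⇒[]=; []=⇒lookup)
open import Function using (_∘_)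
open import Relation.Binary using (Symmetric; tri<; tri≈; tri>)
open import Relation.Binary.PropositionalEquality using (_≡_; _≢_; refl; trans; subst; ≢-sym)
import Relation.Binary.PropositionalEquality as ≡
open import Relation.Nullary using (¬_; Dec; yes; no)
open import Relation.Nullary.Decidable using (_×-dec_; _→-dec_; ¬?; decidable-stable)
open import Induction.WellFounded using (Acc; acc)

AllPairs⇒lookup : ∀ {A : Set} {R : A → A → Set} {xs : List A} → Symmetric R → AllPairs R xs →
  ∀ i j → i ≢ j → R (lookup xs i) (lookup xs j)
AllPairs⇒lookup R-sym (_ ∷ _)     Fin.zero    Fin.zero    i≢j = ⊥-elim (i≢j refl)
AllPairs⇒lookup R-sym (x∼xs ∷ _)  Fin.zero    (Fin.suc j) _   = All.lookup x∼xs (∈-lookup j)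
AllPairs⇒lookup R-sym (x∼xs ∷ _)  (Fin.suc i) Fin.zero    _   = R-sym (All.lookup x∼xs (∈-lookup i))
AllPairs⇒lookup R-sym (_ ∷ xs∼)   (Fin.suc i) (Fin.suc j) i≢j =
  AllPairs⇒lookup R-sym xs∼ i j (i≢j ∘ ≡.cong Fin.suc)

map-proj₁-toList : ∀ {A : Set} {P : A → Set} {xs : List A} (pxs : All P xs) →
  map proj₁ (All.toList pxs) ≡ xs
map-proj₁-toList []         = refl
map-proj₁-toList (px ∷ pxs) = ≡.cong (_ ∷_) (map-proj₁-toList pxs)

⊈⇒∃∉ : ∀ {n} {p q : Subset n} → ¬ p ⊆ q → ∃ λ x → x ∈ p × x ∉ q
⊈⇒∃∉ {p = p} {q} p⊈q with any? (λ x → x ∈? p ×-dec ¬? (x ∈? q))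
... | yes witness = witness
... | no ∄witness = ⊥-elim (p⊈q λ {x} x∈p →
  decidable-stable (x ∈? q) λ x∉q → ∄witness (x , x∈p , x∉q))

module _ {n : ℕ} (G : Graph n) where

  independent≤cover : ∀ {A C} → IndependentEdges G A → EdgeCliqueCover G C → length A ≤ length C
  independent≤cover {A} {C} independent (cliques , covers) = injective⇒≤ clique-of-injective
    where
    clique-of : Fin (length A) → Fin (length C)
    clique-of i = proj₁ (covers (lookup A i))

    clique-of-injective : ∀ {i j} → clique-of i ≡ clique-of j → i ≡ j
    clique-of-injective {i} {j} same = decidable-stable (i ≟ j) λ i≢j →
      independent i j i≢j
        ( lookup C (clique-of i) , cliques (clique-of i) , proj₂ (covers (lookup A i))
        , subst (EdgeIn G (lookup A j) ∘ lookup C) (≡.sym same) (proj₂ (covers (lookup A j))))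

  same-length⇒optimal : ∀ {A C} → IndependentEdges G A → EdgeCliqueCover G C →
    length A ≡ length C → EdgeIndependenceNumber G (length A) × EdgeCliqueCoverNumber G (length A)
  same-length⇒optimal {A} {C} independent cover |A|≡|C| =
    ( (A , independent , refl)
    , λ A′ independent′ →
        subst (length A′ ≤_) (≡.sym |A|≡|C|) (independent≤cover {A′} {C} independent′ cover))
    , ( (C , cover , ≡.sym |A|≡|C|)
      , λ C′ cover′ → independent≤cover {A} {C′} independent cover′)

  Adj? : ∀ u v → Dec (Adj G u v)
  Adj? u v = adj G u v Bool.≟ true

  Adj-sym : ∀ {u v} → Adj G u v → Adj G v u
  Adj-sym {u} {v} uv = trans (sym G v u) uv

  Adj⇒≢ : ∀ {u v} → Adj G u v → u ≢ v
  Adj⇒≢ {u} uv refl with trans (≡.sym (irrefl G u)) uv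
  ... | ()

  N : Fin n → Subset n
  N s = tabulate (adj G s)

  N[_] : Fin n → Subset n
  N[ s ] = ⁅ s ⁆ ∪ N s

  s∈N[s] : ∀ {s} → s ∈ N[ s ]
  s∈N[s] {s} = x∈p∪q⁺ (inj₁ (x∈⁅x⁆ s))

  Adj⇒∈N[] : ∀ {s u} → Adj G s u → u ∈ N[ s ]
  Adj⇒∈N[] {s} {u} su = x∈p∪q⁺ (inj₂ (lookup⇒[]= u (N s) (trans (lookup∘tabulate (adj G s) u) su)))

  ∈N[]⇒≡⊎Adj : ∀ {s u} → u ∈ N[ s ] → u ≡ s ⊎ Adj G s u
  ∈N[]⇒≡⊎Adj {s} {u} u∈N[s] = Sum.map (x∈⁅y⁆⇒x≡y s) ∈N⇒Adj (x∈p∪q⁻ ⁅ s ⁆ (N s) u∈N[s])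
    where
    ∈N⇒Adj : u ∈ N s → Adj G s u
    ∈N⇒Adj u∈N = trans (≡.sym (lookup∘tabulate (adj G s) u)) ([]=⇒lookup u∈N)

  ∈N[]⇒Adj : ∀ {s u} → u ∈ N[ s ] → u ≢ s → Adj G s u
  ∈N[]⇒Adj u∈N[s] u≢s with ∈N[]⇒≡⊎Adj u∈N[s]
  ... | inj₁ u≡s = ⊥-elim (u≢s u≡s)
  ... | inj₂ su  = su

  ∉N[] : ∀ {s u} → u ≢ s → ¬ Adj G s u → u ∉ N[ s ]
  ∉N[] u≢s ¬su u∈N[s] = ¬su (∈N[]⇒Adj u∈N[s] u≢s)

  ∈N[]-sym : ∀ {s u} → u ∈ N[ s ] → s ∈ N[ u ]
  ∈N[]-sym u∈N[s] with ∈N[]⇒≡⊎Adj u∈N[s]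
  ... | inj₁ refl = s∈N[s]
  ... | inj₂ su   = Adj⇒∈N[] (Adj-sym su)

  ⊆N[]⇒∈N[] : ∀ {t a} → N[ t ] ⊆ N[ a ] → a ∈ N[ t ]
  ⊆N[]⇒∈N[] N[t]⊆N[a] = ∈N[]-sym (N[t]⊆N[a] s∈N[s])

  ∈N[]-pair⇒neighbour : ∀ {v a b} → a ∈ N[ v ] → b ∈ N[ v ] → a ≢ b → ∃ (Adj G v)
  ∈N[]-pair⇒neighbour {v} {a} {b} a∈N[v] b∈N[v] a≢b with a ≟ v
  ... | yes refl = b , ∈N[]⇒Adj b∈N[v] (≢-sym a≢b)
  ... | no  a≢v  = a , ∈N[]⇒Adj a∈N[v] a≢v

  IsClique? : ∀ S → Dec (IsClique G S)
  IsClique? S = all? λ u → all? λ v → u ∈? S →-dec v ∈? S →-dec ¬? (u ≟ v) →-dec Adj? u v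

  ¬IsClique⇒non-edge : ∀ {S} → ¬ IsClique G S →
    ∃₂ λ u v → u ∈ S × v ∈ S × u ≢ v × ¬ Adj G u v
  ¬IsClique⇒non-edge {S} ¬clique
    with any? (λ u → any? λ v → u ∈? S ×-dec v ∈? S ×-dec ¬? (u ≟ v) ×-dec ¬? (Adj? u v))
  ... | yes (u , v , non-edge) = u , v , non-edge
  ... | no ∄non-edge = ⊥-elim (¬clique λ u v u∈S v∈S u≢v →
    decidable-stable (Adj? u v) λ ¬uv → ∄non-edge (u , v , u∈S , v∈S , u≢v , ¬uv))

  ¬CommonClique-sym : ∀ {e f} → ¬ CommonClique G e f → ¬ CommonClique G f e
  ¬CommonClique-sym ¬common (S , clique , f⊆S , e⊆S) = ¬common (S , clique , e⊆S , f⊆S)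

  incident-edge : ∀ {v w} → Adj G v w → Σ (Edge G) λ e → ∀ {S} → EdgeIn G e S → v ∈ S
  incident-edge {v} {w} vw with <-cmp v w
  ... | tri< v<w _ _ = ((v , w) , v<w , vw) , proj₁
  ... | tri≈ _ v≡w _ = ⊥-elim (Adj⇒≢ vw v≡w)
  ... | tri> _ _ w<v = ((w , v) , w<v , Adj-sym vw) , proj₂

  nonadjacent⇒¬CommonClique : ∀ {e f u v} → (∀ {S} → EdgeIn G e S → u ∈ S) →
    (∀ {S} → EdgeIn G f S → v ∈ S) → u ≢ v → ¬ Adj G u v → ¬ CommonClique G e f
  nonadjacent⇒¬CommonClique e∋u f∋v u≢v ¬uv (S , clique , e⊆S , f⊆S) =
    ¬uv (clique _ _ (e∋u e⊆S) (f∋v f⊆S) u≢v)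

  Simplicial : Fin n → Set
  Simplicial s = IsClique G N[ s ]

  Simplicial? : ∀ s → Dec (Simplicial s)
  Simplicial? s = IsClique? N[ s ]

  Simplicial-⊆ : ∀ {s u} → Simplicial s → u ∈ N[ s ] → N[ s ] ⊆ N[ u ]
  Simplicial-⊆ {s} {u} simplicial u∈N[s] {z} z∈N[s] with z ≟ u
  ... | yes refl = s∈N[s]
  ... | no  z≢u  = Adj⇒∈N[] (simplicial u z u∈N[s] z∈N[s] (≢-sym z≢u))

  MinimalSimplicial : Fin n → Set
  MinimalSimplicial v = Simplicial v × (∀ u → u < v → Simplicial u → ¬ Adj G u v)

  minimal-simplicial-⊇ : ∀ {s} → Simplicial s → ∃ λ v → MinimalSimplicial v × N[ s ] ⊆ N[ v ]
  minimal-simplicial-⊇ {s} simplicial = go s simplicial (<-wellFounded s)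
    where
    go : ∀ s → Simplicial s → Acc _<_ s → ∃ λ v → MinimalSimplicial v × N[ s ] ⊆ N[ v ]
    go s simplicial (acc smaller)
      with any? (λ u → u <? s ×-dec Simplicial? u ×-dec Adj? u s)
    ... | no ∄smaller =
      s , (simplicial , λ u u<s simplicial-u us → ∄smaller (u , u<s , simplicial-u , us)) , ⊆-refl
    ... | yes (u , u<s , simplicial-u , us) with go u simplicial-u (smaller u<s)
    ...   | v , minimal , N[u]⊆N[v] =
      v , minimal , ⊆-trans (Simplicial-⊆ simplicial (Adj⇒∈N[] (Adj-sym us))) N[u]⊆N[v]

  minimal-simplicial-nonadjacent : ∀ {u v} → MinimalSimplicial u → MinimalSimplicial v → u ≢ v →
    ¬ Adj G u v
  minimal-simplicial-nonadjacent {u} {v} (simplicial-u , minimal-u) (simplicial-v , minimal-v) u≢v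
    with <-cmp u v
  ... | tri< u<v _ _ = minimal-v u u<v simplicial-u
  ... | tri≈ _ u≡v _ = ⊥-elim (u≢v u≡v)
  ... | tri> _ _ v<u = minimal-u v v<u simplicial-v ∘ Adj-sym

  MinimalSimplicial? : ∀ v → Dec (MinimalSimplicial v)
  MinimalSimplicial? v = Simplicial? v ×-dec all? λ u → u <? v →-dec Simplicial? u →-dec ¬? (Adj? u v)

  Representative : Fin n → Set
  Representative v = MinimalSimplicial v × ∃ (Adj G v)

  Representative? : ∀ v → Dec (Representative v)
  Representative? v = MinimalSimplicial? v ×-dec any? (Adj? v)

  representatives : List (∃ Representative)
  representatives = All.toList (all-filter Representative? (allFin n))

  representatives-distinct : AllPairs (λ p q → proj₁ p ≢ proj₁ q) representatives
  representatives-distinct = AllPairs.map⁻ (subst Unique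
    (≡.sym (map-proj₁-toList (all-filter Representative? (allFin n))))
    (Unique.filter⁺ Representative? (Unique.allFin⁺ n)))

  Representative⇒∈representatives : ∀ {v} → Representative v →
    Any (λ p → v ≡ proj₁ p) representatives
  Representative⇒∈representatives {v} representative = Any.map⁻ (subst (Any (v ≡_))
    (≡.sym (map-proj₁-toList (all-filter Representative? (allFin n))))
    (∈-filter⁺ Representative? (∈-allFin v) representative))

  edge-at : ∃ Representative → Edge G
  edge-at (_ , _ , _ , vw) = proj₁ (incident-edge vw)

  edges-at-representatives : List (Edge G)
  edges-at-representatives = map edge-at representatives

  edges-at-representatives-independent : IndependentEdges G edges-at-representatives
  edges-at-representatives-independent =
    AllPairs⇒lookup {A = Edge G} {R = λ e f → ¬ CommonClique G e f}
    (λ {e} {f} → ¬CommonClique-sym {e} {f})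
    (AllPairs.map⁺ (AllPairs.map (λ {p} {q} → separated p q) representatives-distinct))
    where
    separated : ∀ p q → proj₁ p ≢ proj₁ q → ¬ CommonClique G (edge-at p) (edge-at q)
    separated p@(u , minimal-u , _ , uw) q@(v , minimal-v , _ , vx) u≢v =
      nonadjacent⇒¬CommonClique {edge-at p} {edge-at q}
        (proj₂ (incident-edge uw)) (proj₂ (incident-edge vx)) u≢v
        (minimal-simplicial-nonadjacent minimal-u minimal-v u≢v)

  N[representatives] : List (Subset n)
  N[representatives] = map (N[_] ∘ proj₁) representatives

  N[representatives]-cliques : ∀ i → IsClique G (lookup N[representatives] i)
  N[representatives]-cliques i = All.lookup cliques (∈-lookup i)
    where
    cliques : All (IsClique G) N[representatives]
    cliques = All.map⁺ (All.universal (proj₁ ∘ proj₁ ∘ proj₂) representatives)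

  module _ (trivially-perfect : TriviallyPerfect G) where

    no-path-without-short-chords : ∀ {z x y w} → z ≢ y → x ≢ w →
      Adj G z x → Adj G x y → Adj G y w → ¬ Adj G z y → ¬ Adj G x w → ⊥
    no-path-without-short-chords {z} {x} {y} {w} z≢y x≢w zx xy yw ¬zy ¬xw with Adj? z w
    ... | yes zw = proj₂ (trivially-perfect x y w z)
      ( Adj⇒≢ xy , x≢w , ≢-sym (Adj⇒≢ zx) , Adj⇒≢ yw , ≢-sym z≢y , ≢-sym (Adj⇒≢ zw)
      , xy , yw , Adj-sym zw , zx , ¬xw , ¬zy ∘ Adj-sym)
    ... | no ¬zw = proj₁ (trivially-perfect z x y w)
      ( Adj⇒≢ zx , z≢y , (λ { refl → ¬xw (Adj-sym zx) }) , Adj⇒≢ xy , x≢w , Adj⇒≢ yw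
      , zx , xy , yw , ¬zy , ¬xw , ¬zw)

    private-neighbour : ∀ {x y z} → Adj G x y → z ∈ N[ x ] → z ∉ N[ y ] →
      Adj G x z × ¬ Adj G y z × z ≢ y
    private-neighbour xy z∈N[x] z∉N[y] =
      ∈N[]⇒Adj z∈N[x] (λ { refl → z∉N[y] (Adj⇒∈N[] (Adj-sym xy)) }) ,
      z∉N[y] ∘ Adj⇒∈N[] ,
      λ { refl → z∉N[y] s∈N[s] }

    N[]-nested : ∀ {x y} → Adj G x y → N[ x ] ⊆ N[ y ] ⊎ N[ y ] ⊆ N[ x ]
    N[]-nested {x} {y} xy with N[ x ] ⊆? N[ y ] | N[ y ] ⊆? N[ x ]
    ... | yes N[x]⊆N[y] | _             = inj₁ N[x]⊆N[y]
    ... | no _          | yes N[y]⊆N[x] = inj₂ N[y]⊆N[x]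
    ... | no N[x]⊈N[y]  | no N[y]⊈N[x]
      with ⊈⇒∃∉ N[x]⊈N[y] | ⊈⇒∃∉ N[y]⊈N[x]
    ... | z , z∈N[x] , z∉N[y] | w , w∈N[y] , w∉N[x]
      with private-neighbour xy z∈N[x] z∉N[y] | private-neighbour (Adj-sym xy) w∈N[y] w∉N[x]
    ... | xz , ¬yz , z≢y | yw , ¬xw , w≢x =
      ⊥-elim (no-path-without-short-chords z≢y (≢-sym w≢x) (Adj-sym xz) xy yw (¬yz ∘ Adj-sym) ¬xw)

    N[]-⊂ : ∀ {s x y} → x ∈ N[ s ] → x ≢ s → y ∈ N[ s ] → y ∉ N[ x ] → N[ x ] ⊂ N[ s ]
    N[]-⊂ x∈N[s] x≢s y∈N[s] y∉N[x] with N[]-nested (∈N[]⇒Adj x∈N[s] x≢s)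
    ... | inj₁ N[s]⊆N[x] = ⊥-elim (y∉N[x] (N[s]⊆N[x] y∈N[s]))
    ... | inj₂ N[x]⊆N[s] = N[x]⊆N[s] , _ , y∈N[s] , y∉N[x]

    ¬Simplicial⇒smaller-N[] : ∀ {s} → ¬ Simplicial s → ∃ λ x → N[ x ] ⊂ N[ s ]
    ¬Simplicial⇒smaller-N[] {s} ¬simplicial with ¬IsClique⇒non-edge ¬simplicial
    ... | u , v , u∈N[s] , v∈N[s] , u≢v , ¬uv with u ≟ s
    ...   | yes refl = v , N[]-⊂ v∈N[s] (≢-sym u≢v) u∈N[s] (∉N[] u≢v (¬uv ∘ Adj-sym))
    ...   | no  u≢s  = u , N[]-⊂ u∈N[s] u≢s v∈N[s] (∉N[] (≢-sym u≢v) ¬uv)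

    simplicial-⊆ : ∀ s → ∃ λ t → Simplicial t × N[ t ] ⊆ N[ s ]
    simplicial-⊆ s = go s (⊂-wellFounded N[ s ])
      where
      go : ∀ s → Acc _⊂_ N[ s ] → ∃ λ t → Simplicial t × N[ t ] ⊆ N[ s ]
      go s (acc smaller) with Simplicial? s
      ... | yes simplicial = s , simplicial , ⊆-refl
      ... | no ¬simplicial with ¬Simplicial⇒smaller-N[] ¬simplicial
      ...   | x , N[x]⊂N[s] with go x (smaller N[x]⊂N[s])
      ...     | t , simplicial , N[t]⊆N[x] = t , simplicial , ⊆-trans N[t]⊆N[x] (proj₁ N[x]⊂N[s])

    edge⊆N[simplicial] : ∀ {a b} → Adj G a b → ∃ λ t → Simplicial t × a ∈ N[ t ] × b ∈ N[ t ]
    edge⊆N[simplicial] {a} {b} ab with N[]-nested ab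
    ... | inj₁ N[a]⊆N[b] with simplicial-⊆ a
    ...   | t , simplicial , N[t]⊆N[a] =
      t , simplicial , ⊆N[]⇒∈N[] N[t]⊆N[a] , ⊆N[]⇒∈N[] (⊆-trans N[t]⊆N[a] N[a]⊆N[b])
    edge⊆N[simplicial] {a} {b} ab | inj₂ N[b]⊆N[a] with simplicial-⊆ b
    ...   | t , simplicial , N[t]⊆N[b] =
      t , simplicial , ⊆N[]⇒∈N[] (⊆-trans N[t]⊆N[b] N[b]⊆N[a]) , ⊆N[]⇒∈N[] N[t]⊆N[b]

    edge⊆N[representative] : ∀ {a b} → Adj G a b →
      ∃ λ v → Representative v × a ∈ N[ v ] × b ∈ N[ v ]
    edge⊆N[representative] {a} {b} ab with edge⊆N[simplicial] ab
    ... | t , simplicial , a∈N[t] , b∈N[t] with minimal-simplicial-⊇ simplicial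
    ...   | v , minimal , N[t]⊆N[v] =
      v , (minimal , ∈N[]-pair⇒neighbour a∈N[v] b∈N[v] (Adj⇒≢ ab)) , a∈N[v] , b∈N[v]
      where
      a∈N[v] : a ∈ N[ v ]
      a∈N[v] = N[t]⊆N[v] a∈N[t]
      b∈N[v] : b ∈ N[ v ]
      b∈N[v] = N[t]⊆N[v] b∈N[t]

    N[representatives]-cover : EdgeCliqueCover G N[representatives]
    N[representatives]-cover =
      N[representatives]-cliques , λ e → Any.index (covering e) , Any.lookup-index (covering e)
      where
      covering : ∀ e → Any (EdgeIn G e) N[representatives]
      covering ((a , b) , _ , ab) with edge⊆N[representative] ab
      ... | v , representative , a∈N[v] , b∈N[v] =
        Any.map⁺ (Any.map (λ { refl → a∈N[v] , b∈N[v] })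
          (Representative⇒∈representatives representative))

theorem8 : ∀ (n : ℕ) (G : Graph n) → Connected G → TriviallyPerfect G →
    ∃ λ (k : ℕ) → EdgeIndependenceNumber G k × EdgeCliqueCoverNumber G k
theorem8 n G _ trivially-perfect =
  length (edges-at-representatives G) ,
  same-length⇒optimal G {edges-at-representatives G} {N[representatives] G}
    (edges-at-representatives-independent G)
    (N[representatives]-cover G trivially-perfect)
    (trans (length-map _ (representatives G)) (≡.sym (length-map _ (representatives G))))
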